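{- Let $a>1$ be an integer and $n$ an overpseudoprime to base $a$. Then for any two divisors $d_1<d_2$ of $n$ (including $1$ and $n$), $h_a(n)$ divides $d_2-d_1$.
   Context: For an integer $m>1$ with $\gcd(m,a)=1$, $h_a(m)$ denotes the multiplicative order of $a$ modulo $m$. The cyclotomic cosets of $a$ modulo $m$ are the orbits of $\{1,2,\ldots,m-1\}$ under $x\mapsto ax\bmod m$; $r_a(m)$ denotes their number. An odd composite number $n$ with $\gcd(n,a)=1$ is called an overpseudoprime to base $a$ if $n=r_a(n)h_a(n)+1$. -}

module Defs where

open import Data.Nat using (ℕ; _+_; _*_; _^_; _%_; _<_; _≤_; NonZero)
open import Data.Nat.Divisibility using (_∣_)
open import Data.Nat.Primality using (Composite)
open import Data.Nat.Coprimality using (Coprime)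
open import Data.Fin using (Fin; toℕ)
open import Data.Product using (_×_; ∃-syntax; Σ)
open import Relation.Binary.PropositionalEquality using (_≡_; _≢_)

_≡_[mod_] : ℕ → ℕ → (m : ℕ) → .{{NonZero m}} → Set
x ≡ y [mod m ] = x % m ≡ y % m

IsOrder : (a m h : ℕ) → .{{NonZero m}} → Set
IsOrder a m h = (0 < h) × ((a ^ h) ≡ 1 [mod m ])
              × (∀ k → 0 < k → (a ^ k) ≡ 1 [mod m ] → h ≤ k)

SameCoset : (a m x y : ℕ) → .{{NonZero m}} → Set
SameCoset a m x y = ∃[ k ] (y ≡ (a ^ k) * x [mod m ])

-- r is the number of cyclotomic cosets of a modulo m, i.e. the number of
-- orbits of {1,...,m-1} under x ↦ a x mod m: there is a system of r
-- pairwise distinct orbit representatives covering every element.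
NumCosets : (a m r : ℕ) → .{{NonZero m}} → Set
NumCosets a m r =
  Σ (Fin r → ℕ) λ rep → ((∀ (i : Fin r) → 1 ≤ rep i × rep i < m)
          × (∀ (i j : Fin r) → SameCoset a m (rep i) (rep j) → i ≡ j)
          × (∀ x → 1 ≤ x → x < m → ∃[ i ] SameCoset a m (rep i) x))

Overpseudoprime : (a n : ℕ) → .{{NonZero n}} → Set
Overpseudoprime a n =
  (n % 2 ≡ 1) × Composite n × Coprime n a
  × (∀ h r → IsOrder a n h → NumCosets a n r → n ≡ r * h + 1)

-- Let h be the order of a modulo n. Every cyclotomic coset has at most h elements, so
-- n − 1 = r h forces each of them to have exactly h, i.e. no a^l with 0 < l < h fixes a
-- nonzero residue. This freeness descends to every divisor d of n (multiply residues modulo d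
-- by n / d), and then the cosets modulo d split 1, …, d − 1 into blocks of size h, so h ∣ d − 1.
module Submission where

open import Defs
open import Data.Nat using (ℕ; zero; suc; _+_; _*_; _^_; _%_; _/_; _∸_; _≤_; _<_; z≤n; s≤s; NonZero; >-nonZero; >-nonZero⁻¹; _≤?_; _<?_)
open import Data.Nat.Properties hiding (_≟_)
open import Data.Nat.DivMod using (%-distribˡ-*; %-congʳ; m%n%n≡m%n; m%n<n; m<n⇒m%n≡m; m≡m%n+[m/n]*n; m%n*o≡m*o%[n*o]; m∣n⇒o%n%m≡o%m)
open import Data.Nat.Divisibility using (_∣_; divides; quotient; quotient≢0; m∣n⇒n≡m*quotient; m%n≡0⇒n∣m; ∣⇒≤; ∣-trans; ∣m+n∣m⇒∣n)
open import Data.Nat.Coprimality using (Coprime; coprime-divisor)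
open import Data.Nat.Induction using (<-rec)
open import Data.Fin using (Fin; zero; suc; toℕ; fromℕ<; punchIn; punchOut; remQuot; combine; _≟_)
open import Data.Fin.Properties using (injective⇒≤; punchIn-punchOut; toℕ-fromℕ<; toℕ-injective; toℕ<n; remQuot-combine; combine-remQuot; combine-injective)
open import Data.List using (List; filter; upTo; length; lookup)
open import Data.List.Membership.Propositional using (_∈_)
open import Data.List.Membership.Propositional.Properties using (∈-filter⁺; ∈-filter⁻; ∈-upTo⁺; ∈-lookup)
open import Data.List.Relation.Unary.All as All using ()
open import Data.List.Relation.Unary.AllPairs using (_∷_)
open import Data.List.Relation.Unary.Any using (index)
open import Data.List.Relation.Unary.Any.Properties using (lookup-index)
open import Data.List.Relation.Unary.Unique.Propositional using (Unique)
open import Data.List.Relation.Unary.Unique.Propositional.Properties using (filter⁺; upTo⁺)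
open import Data.Empty using (⊥-elim)
open import Data.Product using (∃-syntax; _×_; _,_; proj₁; proj₂; uncurry)
open import Function using (_∘_)
open import Function.Definitions using (Injective; StrictlySurjective)
open import Relation.Binary.Definitions using (Tri; tri<; tri≈; tri>)
open import Relation.Binary.PropositionalEquality
open import Relation.Nullary using (¬_; yes; no)
open import Relation.Nullary.Decidable using (_×-dec_)
open import Relation.Unary using (Decidable)

surjective⇒≥ : ∀ {m n} {f : Fin m → Fin n} → StrictlySurjective _≡_ f → n ≤ m
surjective⇒≥ {f = f} surj = injective⇒≤ {f = proj₁ ∘ surj} λ {x} {y} e →
  trans (sym (proj₂ (surj x))) (trans (cong f e) (proj₂ (surj y)))

-- Deleting u from the domain keeps f surjective, since v still hits f u.
surjective∧collision⇒< : ∀ {m n} {f : Fin m → Fin n} → StrictlySurjective _≡_ f →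
                         ∀ {u v} → u ≢ v → f u ≡ f v → n < m
surjective∧collision⇒< {suc m} {n} {f} surj {u} {v} u≢v fu≡fv = s≤s (surjective⇒≥ surj′)
  where
  surj′ : StrictlySurjective _≡_ (f ∘ punchIn u)
  surj′ y with surj y
  ... | x , fx≡y with u ≟ x
  ...   | yes refl = punchOut u≢v , trans (cong f (punchIn-punchOut u≢v)) (trans (sym fu≡fv) fx≡y)
  ...   | no u≢x = punchOut u≢x , trans (cong f (punchIn-punchOut u≢x)) fx≡y

unique⇒lookup-injective : ∀ {A : Set} {xs : List A} → Unique xs →
                          ∀ i j → lookup xs i ≡ lookup xs j → i ≡ j
unique⇒lookup-injective (_ ∷ _) zero zero _ = refl
unique⇒lookup-injective (x∉ ∷ _) zero (suc j) e = ⊥-elim (All.lookup x∉ (∈-lookup j) e)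
unique⇒lookup-injective (x∉ ∷ _) (suc i) zero e = ⊥-elim (All.lookup x∉ (∈-lookup i) (sym e))
unique⇒lookup-injective (_ ∷ u) (suc i) (suc j) e = cong suc (unique⇒lookup-injective u i j e)

∣∸1⇒∣∸ : ∀ {d m n} → 0 < m → m ≤ n → d ∣ m ∸ 1 → d ∣ n ∸ 1 → d ∣ n ∸ m
∣∸1⇒∣∸ {d} {suc m} {suc n} _ (s≤s m≤n) d∣m d∣n =
  ∣m+n∣m⇒∣n (subst (d ∣_) (sym (m+[n∸m]≡n m≤n)) d∣n) d∣m

<∸1⇒suc< : ∀ {t m} → t < m ∸ 1 → suc t < m
<∸1⇒suc< {m = suc m} t<m = s≤s t<m

divisor-nonZero : ∀ {d n} .{{_ : NonZero n}} → d ∣ n → NonZero d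
divisor-nonZero (divides q refl) = m*n≢0⇒n≢0 q

divisor-coprime : ∀ {d n a} → d ∣ n → Coprime n a → Coprime d a
divisor-coprime d∣n cop (i∣d , i∣a) = cop (∣-trans i∣d d∣n , i∣a)

coprime-pow-divisor : ∀ {m a x} k → Coprime m a → m ∣ a ^ k * x → m ∣ x
coprime-pow-divisor {m} {x = x} zero _ m∣x = subst (m ∣_) (+-identityʳ x) m∣x
coprime-pow-divisor {m} {a} {x} (suc k) cop m∣ = coprime-pow-divisor k cop
  (coprime-divisor cop (subst (m ∣_) (*-assoc a (a ^ k) x) m∣))

module _ {m : ℕ} .{{_ : NonZero m}} where

  *-congˡ-mod : ∀ z {x y} → x ≡ y [mod m ] → (z * x) ≡ (z * y) [mod m ]
  *-congˡ-mod z {x} {y} x≡y = begin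
    z * x % m             ≡⟨ %-distribˡ-* z x m ⟩
    z % m * (x % m) % m   ≡⟨ cong (λ t → z % m * t % m) x≡y ⟩
    z % m * (y % m) % m   ≡⟨ %-distribˡ-* z y m ⟨
    z * y % m             ∎
    where open ≡-Reasoning

  *-congʳ-mod : ∀ z {x y} → x ≡ y [mod m ] → (x * z) ≡ (y * z) [mod m ]
  *-congʳ-mod z {x} {y} x≡y = subst₂ (λ s t → s ≡ t [mod m ]) (*-comm z x) (*-comm z y) (*-congˡ-mod z x≡y)

  ≡-mod-∣ : ∀ {d x y} .{{_ : NonZero d}} → d ∣ m → x ≡ y [mod m ] → x ≡ y [mod d ]
  ≡-mod-∣ {d} {x} {y} d∣m x≡y =
    trans (sym (m∣n⇒o%n%m≡o%m d m x d∣m)) (trans (cong (_% d) x≡y) (m∣n⇒o%n%m≡o%m d m y d∣m))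

-- When h is the order of a, this says that every cyclotomic coset modulo m has exactly h elements.
FreeAction : (m a h : ℕ) → .{{NonZero m}} → Set
FreeAction m a h = ∀ x → 1 ≤ x → x < m → ∀ l → 0 < l → l < h → ¬ ((a ^ l * x) ≡ x [mod m ])

-- Multiplication by the cofactor q embeds the residues modulo d into those modulo n = d q.
freeAction-∣ : ∀ {a h d n} .{{_ : NonZero d}} .{{_ : NonZero n}} →
               d ∣ n → FreeAction n a h → FreeAction d a h
freeAction-∣ {a} {h} {d} {n} d∣n free x 1≤x x<d l l>0 l<h a^lx≡x =
  free (x * q) (*-mono-≤ 1≤x (>-nonZero⁻¹ q)) xq<n l l>0 l<h (begin
    a ^ l * (x * q) % n   ≡⟨ cong (_% n) (*-assoc (a ^ l) x q) ⟨
    a ^ l * x * q % n     ≡⟨ scale (a ^ l * x) ⟨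
    a ^ l * x % d * q     ≡⟨ cong (_* q) a^lx≡x ⟩
    x % d * q             ≡⟨ scale x ⟩
    x * q % n             ∎)
  where
  open ≡-Reasoning
  q : ℕ
  q = quotient d∣n
  n≡dq : n ≡ d * q
  n≡dq = m∣n⇒n≡m*quotient d∣n
  instance
    q≢0 : NonZero q
    q≢0 = quotient≢0 d∣n
    dq≢0 : NonZero (d * q)
    dq≢0 = m*n≢0 d q
  xq<n : x * q < n
  xq<n = subst (x * q <_) (sym n≡dq) (*-monoˡ-< q x<d)
  scale : ∀ y → y % d * q ≡ y * q % n
  scale y = trans (m%n*o≡m*o%[n*o] y d q) (%-congʳ (sym n≡dq))

module ModularPower (m a h : ℕ) .{{_ : NonZero m}} (h>0 : 0 < h) (a^h≡1 : (a ^ h) ≡ 1 [mod m ]) where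

  private instance
    h≢0 : NonZero h
    h≢0 = >-nonZero h>0

  act : ℕ → ℕ → ℕ
  act k x = a ^ k * x

  act-+ : ∀ j k x → act j (act k x) ≡ act (j + k) x
  act-+ j k x = trans (sym (*-assoc (a ^ j) (a ^ k) x)) (cong (_* x) (sym (^-distribˡ-+-* a j k)))

  act-cong : ∀ k {x y} → x ≡ y [mod m ] → act k x ≡ act k y [mod m ]
  act-cong k = *-congˡ-mod (a ^ k)

  act-h : ∀ x → act h x ≡ x [mod m ]
  act-h x = trans (*-congʳ-mod x a^h≡1) (cong (_% m) (*-identityˡ x))

  act-h* : ∀ q x → act (h * q) x ≡ x [mod m ]
  act-h* zero x = trans (cong (λ e → act e x % m) (*-zeroʳ h)) (cong (_% m) (*-identityˡ x))
  act-h* (suc q) x = begin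
    act (h * suc q) x % m       ≡⟨ cong (λ e → act e x % m) (*-suc h q) ⟩
    act (h + h * q) x % m       ≡⟨ cong (_% m) (act-+ h (h * q) x) ⟨
    act h (act (h * q) x) % m   ≡⟨ act-h (act (h * q) x) ⟩
    act (h * q) x % m           ≡⟨ act-h* q x ⟩
    x % m                       ∎
    where open ≡-Reasoning

  act-mod-period : ∀ k x → act k x ≡ act (k % h) x [mod m ]
  act-mod-period k x = begin
    act k x % m                           ≡⟨ cong (λ e → act e x % m) k≡ ⟩
    act (k % h + h * (k / h)) x % m       ≡⟨ cong (_% m) (act-+ (k % h) (h * (k / h)) x) ⟨
    act (k % h) (act (h * (k / h)) x) % m ≡⟨ act-cong (k % h) (act-h* (k / h) x) ⟩
    act (k % h) x % m                     ∎
    where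
    open ≡-Reasoning
    k≡ : k ≡ k % h + h * (k / h)
    k≡ = trans (m≡m%n+[m/n]*n k h) (cong (k % h +_) (*-comm (k / h) h))

  -- a^(h ∸ 1) inverts a modulo m.
  inv : ℕ → ℕ
  inv k = (h ∸ 1) * k

  act-inv : ∀ k x → act (inv k) (act k x) ≡ x [mod m ]
  act-inv k x = trans (cong (_% m) (trans (act-+ (inv k) k x) (cong (λ e → act e x) inv-k+k))) (act-h* k x)
    where
    inv-k+k : inv k + k ≡ h * k
    inv-k+k = trans (cong (inv k +_) (sym (*-identityˡ k)))
                    (trans (sym (*-distribʳ-+ k (h ∸ 1) 1)) (cong (_* k) (m∸n+n≡m h>0)))

  act-cancel : ∀ k {x y} → act k x ≡ act k y [mod m ] → x ≡ y [mod m ]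
  act-cancel k {x} {y} e = trans (sym (act-inv k x)) (trans (act-cong (inv k) e) (act-inv k y))

  sameCoset-refl : ∀ x → SameCoset a m x x
  sameCoset-refl x = 0 , cong (_% m) (sym (*-identityˡ x))

  sameCoset-sym : ∀ {x y} → SameCoset a m x y → SameCoset a m y x
  sameCoset-sym {x} {y} (k , y≡) = inv k , sym (trans (act-cong (inv k) y≡) (act-inv k x))

  sameCoset-trans : ∀ {x y z} → SameCoset a m x y → SameCoset a m y z → SameCoset a m x z
  sameCoset-trans {x} (j , y≡) (k , z≡) =
    k + j , trans z≡ (trans (act-cong k y≡) (cong (_% m) (act-+ k j x)))

  sameCoset-%-act : ∀ k x → SameCoset a m x (act k x % m)
  sameCoset-%-act k x = k , m%n%n≡m%n (act k x) m

  fixed-sameCoset : ∀ {x y} l → SameCoset a m x y → act l y ≡ y [mod m ] → act l x ≡ x [mod m ]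
  fixed-sameCoset {x} {y} l (k , y≡) fixed = act-cancel k (begin
    act k (act l x) % m   ≡⟨ cong (_% m) (trans (act-+ k l x) (cong (λ e → act e x) (+-comm k l))) ⟩
    act (l + k) x % m     ≡⟨ cong (_% m) (act-+ l k x) ⟨
    act l (act k x) % m   ≡⟨ act-cong l y≡ ⟨
    act l y % m           ≡⟨ fixed ⟩
    y % m                 ≡⟨ y≡ ⟩
    act k x % m           ∎)
    where open ≡-Reasoning

module Cosets (m a h : ℕ) .{{_ : NonZero m}} (cop : Coprime m a)
              (h>0 : 0 < h) (a^h≡1 : (a ^ h) ≡ 1 [mod m ]) where

  open ModularPower m a h h>0 a^h≡1

  private instance
    h≢0 : NonZero h
    h≢0 = >-nonZero h>0

  act-positive : ∀ k x → 1 ≤ x → x < m → 0 < act k x % m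
  act-positive k x 1≤x x<m = n≢0⇒n>0 λ act≡0 → <⇒≱ x<m
    (∣⇒≤ {{>-nonZero 1≤x}} (coprime-pow-divisor k cop (m%n≡0⇒n∣m (act k x) m act≡0)))

  -- The least element of each coset, its leader, serves as its representative.
  Leader : ℕ → Set
  Leader x = ∀ {k} → k < h → x ≤ act k x % m

  IsLeader : ℕ → Set
  IsLeader x = 1 ≤ x × x < m × Leader x

  isLeader? : Decidable IsLeader
  isLeader? x = (1 ≤? x) ×-dec (x <? m) ×-dec allUpTo? (λ k → x ≤? act k x % m) h

  leader-≤ : ∀ {y z} → Leader y → SameCoset a m y z → z < m → y ≤ z
  leader-≤ {y} {z} leader (k , z≡) z<m = begin
    y                   ≤⟨ leader (m%n<n k h) ⟩
    act (k % h) y % m   ≡⟨ act-mod-period k y ⟨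
    act k y % m         ≡⟨ z≡ ⟨
    z % m               ≡⟨ m<n⇒m%n≡m z<m ⟩
    z                   ∎
    where open ≤-Reasoning

  leaders-unique : ∀ {y z} → IsLeader y → IsLeader z → SameCoset a m y z → y ≡ z
  leaders-unique (_ , y<m , y-leader) (_ , z<m , z-leader) y~z =
    ≤-antisym (leader-≤ y-leader y~z z<m) (leader-≤ z-leader (sameCoset-sym y~z) y<m)

  -- Descend along the coset while some a^k x mod m is smaller than x.
  leader-of : ∀ x → 1 ≤ x → x < m → ∃[ y ] (IsLeader y × SameCoset a m y x)
  leader-of = <-rec _ descend
    where
    descend : ∀ x → (∀ {z} → z < x → 1 ≤ z → z < m → ∃[ y ] (IsLeader y × SameCoset a m y z)) →
              1 ≤ x → x < m → ∃[ y ] (IsLeader y × SameCoset a m y x)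
    descend x rec 1≤x x<m with anyUpTo? (λ k → act k x % m <? x) h
    ... | no ¬smaller =
      x , (1≤x , x<m , λ k<h → ≮⇒≥ λ smaller → ¬smaller (_ , k<h , smaller)) , sameCoset-refl x
    ... | yes (k , _ , smaller) with rec smaller (act-positive k x 1≤x x<m) (m%n<n (act k x) m)
    ...   | y , leader , y~z = y , leader , sameCoset-trans y~z (sameCoset-sym (sameCoset-%-act k x))

  leaders : List ℕ
  leaders = filter isLeader? (upTo m)

  numCosets : NumCosets a m (length leaders)
  numCosets = lookup leaders , range , distinct , covers
    where
    isLeader-lookup : ∀ i → IsLeader (lookup leaders i)
    isLeader-lookup i = proj₂ (∈-filter⁻ isLeader? {xs = upTo m} (∈-lookup i))
    range : ∀ i → 1 ≤ lookup leaders i × lookup leaders i < m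
    range i = proj₁ (isLeader-lookup i) , proj₁ (proj₂ (isLeader-lookup i))
    distinct : ∀ i j → SameCoset a m (lookup leaders i) (lookup leaders j) → i ≡ j
    distinct i j c = unique⇒lookup-injective (filter⁺ isLeader? (upTo⁺ m)) i j
      (leaders-unique (isLeader-lookup i) (isLeader-lookup j) c)
    covers : ∀ x → 1 ≤ x → x < m → ∃[ i ] SameCoset a m (lookup leaders i) x
    covers x 1≤x x<m with leader-of x 1≤x x<m
    ... | y , leader@(_ , y<m , _) , y~x = index y∈ , subst (λ t → SameCoset a m t x) (lookup-index y∈) y~x
      where
      y∈ : y ∈ leaders
      y∈ = ∈-filter⁺ isLeader? (∈-upTo⁺ y<m) leader

  module Counting {r : ℕ} (cosets : NumCosets a m r) where

    rep : Fin r → ℕ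
    rep = proj₁ cosets

    rep-range : ∀ i → 1 ≤ rep i × rep i < m
    rep-range = proj₁ (proj₂ cosets)

    rep-distinct : ∀ i j → SameCoset a m (rep i) (rep j) → i ≡ j
    rep-distinct = proj₁ (proj₂ (proj₂ cosets))

    rep-covers : ∀ x → 1 ≤ x → x < m → ∃[ i ] SameCoset a m (rep i) x
    rep-covers = proj₂ (proj₂ (proj₂ cosets))

    orbit : Fin r → ℕ → ℕ
    orbit i k = act k (rep i) % m

    orbit-positive : ∀ i k → 1 ≤ orbit i k
    orbit-positive i k = act-positive k (rep i) (proj₁ (rep-range i)) (proj₂ (rep-range i))

    orbit-injectiveˡ : ∀ {i j} k l → orbit i k ≡ orbit j l → i ≡ j
    orbit-injectiveˡ {i} {j} k l e = rep-distinct i j (sameCoset-trans (sameCoset-%-act k (rep i))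
      (subst (λ t → SameCoset a m t (rep j)) (sym e) (sameCoset-sym (sameCoset-%-act l (rep j)))))

    orbit-fixed : ∀ i k l → orbit i k ≡ orbit i (k + l) → act l (rep i) ≡ rep i [mod m ]
    orbit-fixed i k l e = act-cancel k (trans (cong (_% m) (act-+ k l (rep i))) (sym e))

    orbit-no-return : FreeAction m a h → ∀ i {k l} → k < l → l < h → orbit i k ≢ orbit i l
    orbit-no-return free i {k} {l} k<l l<h e =
      free (rep i) (proj₁ (rep-range i)) (proj₂ (rep-range i)) (l ∸ k) (m<n⇒0<n∸m k<l)
           (≤-<-trans (m∸n≤m l k) l<h) (orbit-fixed i k (l ∸ k) (trans e (cong (orbit i) (sym (m+[n∸m]≡n (<⇒≤ k<l))))))

    -- A nonzero residue v is encoded as v ∸ 1 : Fin (m ∸ 1).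
    orbitMap : Fin r × Fin h → Fin (m ∸ 1)
    orbitMap (i , k) = fromℕ< (∸-monoˡ-< (m%n<n (act (toℕ k) (rep i)) m) (orbit-positive i (toℕ k)))

    toℕ-orbitMap : ∀ i k → toℕ (orbitMap (i , k)) ≡ orbit i (toℕ k) ∸ 1
    toℕ-orbitMap i k = toℕ-fromℕ< (∸-monoˡ-< (m%n<n (act (toℕ k) (rep i)) m) (orbit-positive i (toℕ k)))

    orbitMap-≡⇒orbit-≡ : ∀ {i j k l} → orbitMap (i , k) ≡ orbitMap (j , l) → orbit i (toℕ k) ≡ orbit j (toℕ l)
    orbitMap-≡⇒orbit-≡ {i} {j} {k} {l} e = ∸-cancelʳ-≡ (orbit-positive i (toℕ k)) (orbit-positive j (toℕ l))
      (trans (sym (toℕ-orbitMap i k)) (trans (cong toℕ e) (toℕ-orbitMap j l)))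

    orbit-≡⇒orbitMap-≡ : ∀ {i j k l} → orbit i (toℕ k) ≡ orbit j (toℕ l) → orbitMap (i , k) ≡ orbitMap (j , l)
    orbit-≡⇒orbitMap-≡ {i} {j} {k} {l} e =
      toℕ-injective (trans (toℕ-orbitMap i k) (trans (cong (_∸ 1) e) (sym (toℕ-orbitMap j l))))

    orbitMap-surjective : StrictlySurjective _≡_ orbitMap
    orbitMap-surjective y = hit (rep-covers (suc (toℕ y)) (s≤s z≤n) y+1<m)
      where
      y+1<m : suc (toℕ y) < m
      y+1<m = <∸1⇒suc< (toℕ<n y)
      hit : ∃[ i ] SameCoset a m (rep i) (suc (toℕ y)) → ∃[ p ] orbitMap p ≡ y
      hit (i , k , y+1≡) = (i , fromℕ< (m%n<n k h)) , toℕ-injective (begin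
        toℕ (orbitMap (i , fromℕ< (m%n<n k h)))   ≡⟨ toℕ-orbitMap i (fromℕ< (m%n<n k h)) ⟩
        orbit i (toℕ (fromℕ< (m%n<n k h))) ∸ 1    ≡⟨ cong (λ e → orbit i e ∸ 1) (toℕ-fromℕ< (m%n<n k h)) ⟩
        act (k % h) (rep i) % m ∸ 1               ≡⟨ cong (_∸ 1) (act-mod-period k (rep i)) ⟨
        act k (rep i) % m ∸ 1                     ≡⟨ cong (_∸ 1) y+1≡ ⟨
        suc (toℕ y) % m ∸ 1                       ≡⟨ cong (_∸ 1) (m<n⇒m%n≡m y+1<m) ⟩
        toℕ y                                     ∎)
        where open ≡-Reasoning

    orbit-injectiveʳ : FreeAction m a h → ∀ i {k l : Fin h} → orbit i (toℕ k) ≡ orbit i (toℕ l) → k ≡ l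
    orbit-injectiveʳ free i {k} {l} e = toℕ-injective (by-cases (<-cmp (toℕ k) (toℕ l)))
      where
      by-cases : Tri (toℕ k < toℕ l) (toℕ k ≡ toℕ l) (toℕ l < toℕ k) → toℕ k ≡ toℕ l
      by-cases (tri< k<l _ _) = ⊥-elim (orbit-no-return free i k<l (toℕ<n l) e)
      by-cases (tri≈ _ k≡l _) = k≡l
      by-cases (tri> _ _ l<k) = ⊥-elim (orbit-no-return free i l<k (toℕ<n k) (sym e))

    orbitMap-injective : FreeAction m a h → Injective _≡_ _≡_ orbitMap
    orbitMap-injective free {i , k} {j , l} e = cong₂ _,_ i≡j
      (orbit-injectiveʳ free j (subst (λ t → orbit t (toℕ k) ≡ orbit j (toℕ l)) i≡j orbits-≡))
      where
      orbits-≡ : orbit i (toℕ k) ≡ orbit j (toℕ l)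
      orbits-≡ = orbitMap-≡⇒orbit-≡ {i} {j} {k} {l} e
      i≡j : i ≡ j
      i≡j = orbit-injectiveˡ (toℕ k) (toℕ l) orbits-≡

    countMap : Fin (r * h) → Fin (m ∸ 1)
    countMap = orbitMap ∘ remQuot h

    countMap-combine : ∀ i k → countMap (combine i k) ≡ orbitMap (i , k)
    countMap-combine i k = cong orbitMap (remQuot-combine i k)

    countMap-surjective : StrictlySurjective _≡_ countMap
    countMap-surjective y =
      let (i , k) , e = orbitMap-surjective y in combine i k , trans (countMap-combine i k) e

    countMap-injective : FreeAction m a h → Injective _≡_ _≡_ countMap
    countMap-injective free {s} {t} e = begin
      s                                  ≡⟨ combine-remQuot {r} h s ⟨
      uncurry combine (remQuot {r} h s)  ≡⟨ cong (uncurry (combine {r}))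
                                              (orbitMap-injective free {remQuot {r} h s} {remQuot {r} h t} e) ⟩
      uncurry combine (remQuot {r} h t)  ≡⟨ combine-remQuot {r} h t ⟩
      t                                  ∎
      where open ≡-Reasoning

    freeAction⇒count : FreeAction m a h → r * h ≡ m ∸ 1
    freeAction⇒count free = ≤-antisym (injective⇒≤ (countMap-injective free)) (surjective⇒≥ countMap-surjective)

    -- A residue fixed by a^l makes its coset representative fixed, so (i , l) and (i , 0) collide.
    count⇒freeAction : r * h ≤ m ∸ 1 → FreeAction m a h
    count⇒freeAction r*h≤ x 1≤x x<m l l>0 l<h fixed =
      <⇒≱ (surjective∧collision⇒< countMap-surjective distinct collide) r*h≤
      where
      i : Fin r
      i = proj₁ (rep-covers x 1≤x x<m)
      rep-fixed : orbit i l ≡ orbit i 0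
      rep-fixed = trans (fixed-sameCoset l (proj₂ (rep-covers x 1≤x x<m)) fixed)
                        (cong (_% m) (sym (*-identityˡ (rep i))))
      distinct : combine i (fromℕ< l<h) ≢ combine i (fromℕ< h>0)
      distinct e = <⇒≢ l>0 (sym (trans (sym (toℕ-fromℕ< l<h))
        (trans (cong toℕ (proj₂ (combine-injective i _ i _ e))) (toℕ-fromℕ< h>0))))
      collide : countMap (combine i (fromℕ< l<h)) ≡ countMap (combine i (fromℕ< h>0))
      collide = trans (countMap-combine i _) (trans (orbit-≡⇒orbitMap-≡ {i} {i} {fromℕ< l<h} {fromℕ< h>0}
        (trans (cong (orbit i) (toℕ-fromℕ< l<h)) (trans rep-fixed (cong (orbit i) (sym (toℕ-fromℕ< h>0))))))
        (sym (countMap-combine i _)))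

  freeAction⇒∣ : FreeAction m a h → h ∣ m ∸ 1
  freeAction⇒∣ free = divides (length leaders) (sym (Counting.freeAction⇒count numCosets free))

  overpseudoprime⇒freeAction : Overpseudoprime a m → IsOrder a m h → FreeAction m a h
  overpseudoprime⇒freeAction (_ , _ , _ , m≡rh+1) order =
    Counting.count⇒freeAction numCosets (≤-reflexive (sym m∸1≡rh))
    where
    m∸1≡rh : m ∸ 1 ≡ length leaders * h
    m∸1≡rh = trans (cong (_∸ 1) (m≡rh+1 h (length leaders) order numCosets)) (m+n∸n≡m (length leaders * h) 1)

freeAction⇒divisor-∣ : ∀ {n a h d} .{{_ : NonZero n}} → Coprime n a → 0 < h → (a ^ h) ≡ 1 [mod n ] →
                       FreeAction n a h → d ∣ n → h ∣ d ∸ 1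
freeAction⇒divisor-∣ {a = a} {h} {d} cop h>0 a^h≡1 free d∣n =
  Cosets.freeAction⇒∣ d a h (divisor-coprime d∣n cop) h>0 (≡-mod-∣ d∣n a^h≡1) (freeAction-∣ d∣n free)
  where instance
    d≢0 : NonZero d
    d≢0 = divisor-nonZero d∣n

theorem14 : (a n : ℕ) → .{{_ : NonZero n}} → 1 < a → Overpseudoprime a n
          → ∀ h → IsOrder a n h
          → ∀ d₁ d₂ → d₁ ∣ n → d₂ ∣ n → d₁ < d₂ → h ∣ (d₂ ∸ d₁)
theorem14 a n _ opp@(_ , _ , cop , _) h order@(h>0 , a^h≡1 , _) d₁ d₂ d₁∣n d₂∣n d₁<d₂ =
  ∣∸1⇒∣∸ (>-nonZero⁻¹ d₁ {{divisor-nonZero d₁∣n}}) (<⇒≤ d₁<d₂) (h∣d∸1 d₁∣n) (h∣d∸1 d₂∣n)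
  where
  free : FreeAction n a h
  free = Cosets.overpseudoprime⇒freeAction n a h cop h>0 a^h≡1 opp order
  h∣d∸1 : ∀ {d} → d ∣ n → h ∣ d ∸ 1
  h∣d∸1 = freeAction⇒divisor-∣ cop h>0 a^h≡1 free
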